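{- Let $J_1$ and $J_2$ be two graphs, $L_1\subseteq V(J_1)$, $L_2\subseteq V(J_2)$, and $S$ a finite set. Then $\tilde{k}(J_1,L_1,S;x,y)\,\tilde{k}(J_2,L_2,S;x,y)$ equals a sum of polynomials $\tilde{k}(J,L,S;x,y)$ (with $L\subseteq V(J)$) where each graph $J$ occurring has at most $|V(J_1)|+|V(J_2)|$ vertices.
   Context: All graphs are finite and simple. For a finite set $S$, $E(K_S)$ is the set of 2-element subsets of $S$, $R_S=\mathbb{R}[x_e \mid e\in E(K_S)]/\langle x_e^2-1\rangle$ (write $x_{ab}$ for $x_{\{a,b\}}$), and $R^\circ_S=R_S[y_v\mid v\in S]/\langle y_v^2-1\mid v\in S\rangle$. $\mathrm{inj}(A,B)$ is the set of injective maps $A\to B$; for an injection $\phi$ and edge $e=uv$, $x_{\phi(e)}$ means $x_{\phi(u)\phi(v)}$. For a graph $J$, $L\subseteq V(J)$ and set $S$, \[ \tilde{k}(J,L,S;x,y) = \sum_{\phi \in \mathrm{inj}(V(J),S)} \prod_{e\in E(J)} x_{\phi(e)} \prod_{u\in L}y_{\phi(u)}\in R^\circ_S. \] -}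

module Defs where

open import Data.Bool using (Bool; true; false; _∧_; _∨_; _xor_; not)
open import Data.Nat using (ℕ; zero; suc; _<ᵇ_)
open import Data.Fin using (Fin; zero; suc; toℕ; _≟_)
open import Data.Fin.Subset using (Subset)
open import Data.Vec using (lookup)
open import Data.List.Base using (List; []; _∷_; [_]; map; concatMap; filterᵇ; foldr; _++_)
open import Data.Integer using (ℤ; 0ℤ; 1ℤ) renaming (_+_ to _+ℤ_; _*_ to _*ℤ_)
open import Data.Product using (_×_; _,_; proj₁; proj₂)
open import Data.Vec.Functional using () renaming (_∷_ to _∷ᶠ_)
open import Relation.Nullary.Decidable using (⌊_⌋)
open import Relation.Binary.PropositionalEquality using (_≡_)

record Graph (m : ℕ) : Set where
  field
    adj    : Fin m → Fin m → Bool
    sym    : ∀ u v → adj u v ≡ adj v u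
    irrefl : ∀ u → adj u u ≡ false
open Graph public

allᵇ : ∀ {A : Set} → (A → Bool) → List A → Bool
allᵇ p = foldr (λ a b → p a ∧ b) true

allFin : (m : ℕ) → List (Fin m)
allFin m = Data.List.Base.allFin m

edges : ∀ {m} → Graph m → List (Fin m × Fin m)
edges {m} J =
  filterᵇ (λ p → (toℕ (proj₁ p) <ᵇ toℕ (proj₂ p)) ∧ adj J (proj₁ p) (proj₂ p))
          (concatMap (λ u → map (λ v → (u , v)) (allFin m)) (allFin m))

-- Multilinear monomials of R°_S with S = Fin n.
-- Since x_e² = 1 and y_v² = 1, a monomial is determined by the set of
-- edges e of K_S and the set of vertices v of S whose variable occurs
-- (to an odd power).  The edge set is stored as a symmetric indicator
-- ex i j (= ex j i, diagonal false for every monomial built below).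

record Mono (n : ℕ) : Set where
  constructor mono
  field
    ex : Fin n → Fin n → Bool
    vy : Fin n → Bool
open Mono public

oneM : ∀ {n} → Mono n
oneM = mono (λ _ _ → false) (λ _ → false)

_*M_ : ∀ {n} → Mono n → Mono n → Mono n
a *M b = mono (λ i j → ex a i j xor ex b i j) (λ i → vy a i xor vy b i)

xM : ∀ {n} → Fin n → Fin n → Mono n
xM a b = mono (λ i j → (⌊ i ≟ a ⌋ ∧ ⌊ j ≟ b ⌋) ∨ (⌊ i ≟ b ⌋ ∧ ⌊ j ≟ a ⌋)) (λ _ → false)

yM : ∀ {n} → Fin n → Mono n
yM v = mono (λ _ _ → false) (λ i → ⌊ i ≟ v ⌋)

_==M_ : ∀ {n} → Mono n → Mono n → Bool
_==M_ {n} a b =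
  allᵇ (λ i → allᵇ (λ j → not (ex a i j xor ex b i j)) (allFin n)) (allFin n)
  ∧ allᵇ (λ i → not (vy a i xor vy b i)) (allFin n)

-- Elements of R°_S (with integer coefficients) as formal sums of
-- monomials; equality in R°_S is equality of all coefficients with
-- respect to the multilinear monomial basis.

Poly : ℕ → Set
Poly n = List (ℤ × Mono n)

_+P_ : ∀ {n} → Poly n → Poly n → Poly n
p +P q = p ++ q

_*P_ : ∀ {n} → Poly n → Poly n → Poly n
p *P q = concatMap (λ s → map (λ t → (proj₁ s *ℤ proj₁ t , proj₂ s *M proj₂ t)) q) p

zeroP : ∀ {n} → Poly n
zeroP = []

sumP : ∀ {n} → List (Poly n) → Poly n
sumP = foldr _+P_ zeroP

coeff : ∀ {n} → Poly n → Mono n → ℤ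
coeff [] m = 0ℤ
coeff ((c , a) ∷ p) m with a ==M m
... | true  = c +ℤ coeff p m
... | false = coeff p m

_≈P_ : ∀ {n} → Poly n → Poly n → Set
p ≈P q = ∀ m → coeff p m ≡ coeff q m

allFuns : (m n : ℕ) → List (Fin m → Fin n)
allFuns zero    n = [ (λ ()) ]
allFuns (suc m) n = concatMap (λ f → map (λ i → i ∷ᶠ f) (allFin n)) (allFuns m n)

isInjᵇ : ∀ {m n} → (Fin m → Fin n) → Bool
isInjᵇ {m} f =
  allᵇ (λ u → allᵇ (λ v → ⌊ u ≟ v ⌋ ∨ not ⌊ f u ≟ f v ⌋) (allFin m)) (allFin m)

inj : (m n : ℕ) → List (Fin m → Fin n)
inj m n = filterᵇ isInjᵇ (allFuns m n)

prodM : ∀ {n} → List (Mono n) → Mono n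
prodM = foldr _*M_ oneM

monoOf : ∀ {m n} → Graph m → Subset m → (Fin m → Fin n) → Mono n
monoOf {m} J L φ =
  prodM (map (λ e → xM (φ (proj₁ e)) (φ (proj₂ e))) (edges J))
  *M prodM (map (λ u → yM (φ u)) (filterᵇ (λ u → lookup L u) (allFin m)))

k̃ : ∀ {m} → Graph m → Subset m → (n : ℕ) → Poly n
k̃ {m} J L n = map (λ φ → (1ℤ , monoOf J L φ)) (inj m n)

module Submission where

-- k̃(J₁,L₁)·k̃(J₂,L₂) is the sum, over pairs (φ₁, φ₂) of injections V(J₁) → S and
-- V(J₂) → S, of the product of their monomials.  Such a pair is the same thing as an
-- overlap p -- a vertex set Fin k with k ≤ |V(J₁)| + |V(J₂)| and injections
-- left : V(J₁) → Fin k, right : V(J₂) → Fin k covering it -- together with an injection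
-- ψ : Fin k → S, via φ₁ = ψ ∘ left and φ₂ = ψ ∘ right.  As x_e² = y_v² = 1, the product of the
-- two monomials is the monomial under ψ of the merged labelled graph of p, whose edges and
-- labels are those of J₁ and J₂ carried along left and right and counted mod 2.  So the
-- product is the sum of k̃(merge p) over all overlaps p.  The overlaps are generated by
-- placing the vertices of J₂ one at a time, on an existing vertex or on a new one; this
-- enumerates all maps right, and those that are not injective contribute nothing.

open import Algebra.Bundles using (CommutativeMonoid; CommutativeRing)
open import Data.Bool using (Bool; true; false; not; _∧_; _∨_; _xor_; if_then_else_)
open import Data.Bool.Properties using (∧-conicalˡ; ∧-conicalʳ; ⇔→≡; xor-∧-commutativeRing; xor-identityʳ)
open import Data.Empty using (⊥-elim)
open import Data.Fin using (Fin; zero; suc; _≟_; toℕ)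
import Data.Fin.Properties as Finₚ
open import Data.Fin.Subset using (Subset)
open import Data.Integer using (ℤ; 0ℤ; 1ℤ)
open import Data.Integer.Properties using (+-0-commutativeMonoid)
open import Data.List using (List; []; _∷_; map; concatMap; filterᵇ; _++_; tabulate)
open import Data.List.Membership.Propositional using (_∈_)
open import Data.List.Membership.Propositional.Properties using (∈-allFin)
open import Data.List.Relation.Unary.Any using (here; there)
open import Data.Nat using (ℕ; zero; suc; _<ᵇ_)
open import Data.Product using (Σ; _×_; _,_; proj₁; proj₂)
open import Data.Vec using (lookup)
open import Data.Vec.Functional using () renaming (_∷_ to _∷ᶠ_)
open import Function using (_∘_; id; case_of_)
open import Function.Bundles using (_⇔_; mk⇔; Equivalence)
open import Function.Definitions using (Injective)
open import Relation.Binary.PropositionalEquality as ≡ using (_≡_)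
open import Relation.Nullary using (¬_; yes; no)
open import Relation.Nullary.Decidable using (⌊_⌋; ⌊⌋-map′; isYes≗does; dec-true; dec-false)

open import Defs hiding (sym)

IsInjective : ∀ {m n} → (Fin m → Fin n) → Set
IsInjective f = Injective _≡_ _≡_ f

module BigSum {c ℓ} (M : CommutativeMonoid c ℓ) where

  open CommutativeMonoid M
  open import Algebra.Properties.CommutativeSemigroup commutativeSemigroup using (interchange)
  open import Algebra.Properties.CommutativeMonoid.Sum M public
    using (sum-syntax; sum-cong-≋; ∑-distrib-+; ∑-comm; sum-replicate-zero)
  open import Relation.Binary.Reasoning.Setoid setoid

  private variable A B : Set

  Σᴸ : List A → (A → Carrier) → Carrier
  Σᴸ []       h = ε
  Σᴸ (x ∷ xs) h = h x ∙ Σᴸ xs h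

  _·_ : Bool → Carrier → Carrier
  b · x = if b then x else ε

  infixr 8 _·_

  Σᴸ-cong : ∀ (xs : List A) {h g : A → Carrier} → (∀ x → h x ≈ g x) → Σᴸ xs h ≈ Σᴸ xs g
  Σᴸ-cong []       h≈g = refl
  Σᴸ-cong (x ∷ xs) h≈g = ∙-cong (h≈g x) (Σᴸ-cong xs h≈g)

  Σᴸ-++ : ∀ (xs ys : List A) h → Σᴸ (xs ++ ys) h ≈ Σᴸ xs h ∙ Σᴸ ys h
  Σᴸ-++ []       ys h = sym (identityˡ _)
  Σᴸ-++ (x ∷ xs) ys h = trans (∙-congˡ (Σᴸ-++ xs ys h)) (sym (assoc _ _ _))

  Σᴸ-map : ∀ (f : A → B) xs h → Σᴸ (map f xs) h ≡ Σᴸ xs (h ∘ f)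
  Σᴸ-map f []       h = ≡.refl
  Σᴸ-map f (x ∷ xs) h = ≡.cong (h (f x) ∙_) (Σᴸ-map f xs h)

  Σᴸ-concatMap : ∀ (f : A → List B) xs h → Σᴸ (concatMap f xs) h ≈ Σᴸ xs (λ x → Σᴸ (f x) h)
  Σᴸ-concatMap f []       h = refl
  Σᴸ-concatMap f (x ∷ xs) h = trans (Σᴸ-++ (f x) _ h) (∙-congˡ (Σᴸ-concatMap f xs h))

  Σᴸ-filter : ∀ (p : A → Bool) xs h → Σᴸ (filterᵇ p xs) h ≈ Σᴸ xs (λ x → p x · h x)
  Σᴸ-filter p []       h = refl
  Σᴸ-filter p (x ∷ xs) h with p x
  ... | true  = ∙-congˡ (Σᴸ-filter p xs h)
  ... | false = trans (Σᴸ-filter p xs h) (sym (identityˡ _))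

  Σᴸ-zero : ∀ (xs : List A) → Σᴸ xs (λ _ → ε) ≈ ε
  Σᴸ-zero []       = refl
  Σᴸ-zero (x ∷ xs) = trans (identityˡ _) (Σᴸ-zero xs)

  Σᴸ-distrib : ∀ (xs : List A) h g → Σᴸ xs (λ x → h x ∙ g x) ≈ Σᴸ xs h ∙ Σᴸ xs g
  Σᴸ-distrib []       h g = sym (identityˡ ε)
  Σᴸ-distrib (x ∷ xs) h g = trans (∙-congˡ (Σᴸ-distrib xs h g)) (interchange _ _ _ _)

  Σᴸ-∑-comm : ∀ (xs : List A) {k} (h : A → Fin k → Carrier) →
    Σᴸ xs (λ x → ∑[ j < k ] h x j) ≈ ∑[ j < k ] Σᴸ xs (λ x → h x j)
  Σᴸ-∑-comm []       {k = k} h = sym (sum-replicate-zero k)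
  Σᴸ-∑-comm (x ∷ xs) {k = k} h =
    trans (∙-congˡ (Σᴸ-∑-comm xs h)) (sym (∑-distrib-+ (h x) (λ j → Σᴸ xs (λ y → h y j))))

  Σᴸ-tabulate : ∀ {k} (f : Fin k → A) h → Σᴸ (tabulate f) h ≡ ∑[ i < k ] h (f i)
  Σᴸ-tabulate {k = zero}  f h = ≡.refl
  Σᴸ-tabulate {k = suc k} f h = ≡.cong (h (f zero) ∙_) (Σᴸ-tabulate (f ∘ suc) h)

  Σᴸ-allFin : ∀ k (h : Fin k → Carrier) → Σᴸ (allFin k) h ≡ ∑[ i < k ] h i
  Σᴸ-allFin k = Σᴸ-tabulate id

  ·-Σᴸ : ∀ b (xs : List A) h → b · Σᴸ xs h ≈ Σᴸ xs (λ x → b · h x)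
  ·-Σᴸ true  xs h = refl
  ·-Σᴸ false xs h = sym (Σᴸ-zero xs)

  ·-∑ : ∀ b {k} (h : Fin k → Carrier) → b · (∑[ i < k ] h i) ≈ ∑[ i < k ] (b · h i)
  ·-∑ true  h = refl
  ·-∑ false {k} h = sym (sum-replicate-zero k)

  ·-exchange : ∀ a b x → a · b · x ≡ b · a · x
  ·-exchange true  b     x = ≡.refl
  ·-exchange false true  x = ≡.refl
  ·-exchange false false x = ≡.refl

  ∑-delta : ∀ {n} (a : Fin n) (h : Fin n → Carrier) → ∑[ i < n ] (⌊ a ≟ i ⌋ · h i) ≈ h a
  ∑-delta {suc n} zero    h = trans (∙-congˡ (sum-replicate-zero n)) (identityʳ _)
  ∑-delta {suc n} (suc a) h =
    trans (identityˡ _) (trans (sum-cong-≋ (λ i → reflexive (≡.cong (_· h (suc i)) (⌊⌋-map′ _ _ (a ≟ i)))))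
                               (∑-delta a (h ∘ suc)))

  ·-distrib : ∀ b x y → b · (x ∙ y) ≈ b · x ∙ b · y
  ·-distrib true  x y = refl
  ·-distrib false x y = sym (identityˡ ε)

  ·-ε : ∀ b → b · ε ≡ ε
  ·-ε true  = ≡.refl
  ·-ε false = ≡.refl

  ∧-· : ∀ c d x → (c ∧ d) · x ≡ c · d · x
  ∧-· true  d x = ≡.refl
  ∧-· false d x = ≡.refl

  push : ∀ {a k} → (Fin a → Fin k) → (Fin a → Carrier) → Fin k → Carrier
  push {a} r g u = ∑[ s < a ] (⌊ r s ≟ u ⌋ · g s)

  ∑-push : ∀ {a k} (r : Fin a → Fin k) (g : Fin a → Carrier) (f : Fin k → Bool) →
    ∑[ u < k ] (f u · push r g u) ≈ ∑[ s < a ] (f (r s) · g s)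
  ∑-push {a} {k} r g f = begin
    ∑[ u < k ] (f u · push r g u)
      ≈⟨ sum-cong-≋ (λ u → ·-∑ (f u) (λ s → ⌊ r s ≟ u ⌋ · g s)) ⟩
    ∑[ u < k ] ∑[ s < a ] (f u · ⌊ r s ≟ u ⌋ · g s)
      ≈⟨ ∑-comm (λ u s → f u · ⌊ r s ≟ u ⌋ · g s) ⟩
    ∑[ s < a ] ∑[ u < k ] (f u · ⌊ r s ≟ u ⌋ · g s)
      ≈⟨ sum-cong-≋ (λ s → sum-cong-≋ (λ u → reflexive (·-exchange (f u) _ (g s)))) ⟩
    ∑[ s < a ] ∑[ u < k ] (⌊ r s ≟ u ⌋ · f u · g s)
      ≈⟨ sum-cong-≋ (λ s → ∑-delta (r s) (λ u → f u · g s)) ⟩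
    ∑[ s < a ] (f (r s) · g s) ∎

module Σℤ = BigSum +-0-commutativeMonoid

module FinEquality where

  ≟-refl : ∀ {n} (a : Fin n) → ⌊ a ≟ a ⌋ ≡ true
  ≟-refl a = ≡.trans (isYes≗does (a ≟ a)) (dec-true (a ≟ a) ≡.refl)

  ≟-≢ : ∀ {n} {a b : Fin n} → ¬ a ≡ b → ⌊ a ≟ b ⌋ ≡ false
  ≟-≢ {a = a} {b} a≢b = ≡.trans (isYes≗does (a ≟ b)) (dec-false (a ≟ b) a≢b)

  ≟-complete : ∀ {n} {a b : Fin n} → a ≡ b → ⌊ a ≟ b ⌋ ≡ true
  ≟-complete ≡.refl = ≟-refl _

  ≟-sound : ∀ {n} {a b : Fin n} → ⌊ a ≟ b ⌋ ≡ true → a ≡ b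
  ≟-sound {a = a} {b} eq with a ≟ b
  ... | yes a≡b = a≡b

  ≟-sym : ∀ {n} (a b : Fin n) → ⌊ a ≟ b ⌋ ≡ ⌊ b ≟ a ⌋
  ≟-sym a b with a ≟ b
  ... | yes ≡.refl = ≡.sym (≟-refl a)
  ... | no a≢b     = ≡.sym (≟-≢ (a≢b ∘ ≡.sym))

open FinEquality

module Injectivity where

  open ≡ using (refl; cong; sym; trans)
  import Function.Properties.Equivalence as ⇔
  open import Data.Product.Function.NonDependent.Propositional using (_×-⇔_)

  ∧-true⇔ : ∀ {a b} → (a ∧ b) ≡ true ⇔ (a ≡ true × b ≡ true)
  ∧-true⇔ = mk⇔ (λ e → ∧-conicalˡ _ _ e , ∧-conicalʳ _ _ e) (λ { (refl , refl) → refl })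

  ∨-not-true⇔ : ∀ {a b} → (a ∨ not b) ≡ true ⇔ (b ≡ true → a ≡ true)
  ∨-not-true⇔ {true}         = mk⇔ (λ _ _ → refl) (λ _ → refl)
  ∨-not-true⇔ {false} {true}  = mk⇔ (λ ()) (λ f → f refl)
  ∨-not-true⇔ {false} {false} = mk⇔ (λ _ ()) (λ _ → refl)

  not-true⇔ : ∀ {b} → not b ≡ true ⇔ (¬ b ≡ true)
  not-true⇔ {true}  = mk⇔ (λ ()) (λ f → ⊥-elim (f refl))
  not-true⇔ {false} = mk⇔ (λ _ ()) (λ _ → refl)

  allᵇ-allFin⇔ : ∀ {k} (p : Fin k → Bool) → allᵇ p (allFin k) ≡ true ⇔ (∀ i → p i ≡ true)
  allᵇ-allFin⇔ {k} p = mk⇔ (λ all i → elim (allFin k) all (∈-allFin i)) (intro (allFin k))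
    where
    elim : ∀ xs → allᵇ p xs ≡ true → ∀ {i} → i ∈ xs → p i ≡ true
    elim (x ∷ xs) all (here refl) = ∧-conicalˡ _ _ all
    elim (x ∷ xs) all (there i∈) = elim xs (∧-conicalʳ _ _ all) i∈
    intro : ∀ xs → (∀ i → p i ≡ true) → allᵇ p xs ≡ true
    intro []       each = refl
    intro (x ∷ xs) each = Equivalence.from ∧-true⇔ (each x , intro xs each)

  isInjᵇ⇔ : ∀ {m n} (f : Fin m → Fin n) → isInjᵇ f ≡ true ⇔ IsInjective f
  isInjᵇ⇔ {m} f = mk⇔ sound complete
    where
    clause : Fin m → Fin m → Bool
    clause u v = ⌊ u ≟ v ⌋ ∨ not ⌊ f u ≟ f v ⌋
    rows⇔ : isInjᵇ f ≡ true ⇔ (∀ u → allᵇ (clause u) (allFin m) ≡ true)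
    rows⇔ = allᵇ-allFin⇔ (λ u → allᵇ (clause u) (allFin m))
    row⇔ : ∀ u → allᵇ (clause u) (allFin m) ≡ true ⇔ (∀ v → clause u v ≡ true)
    row⇔ u = allᵇ-allFin⇔ (clause u)
    sound : isInjᵇ f ≡ true → IsInjective f
    sound ok {u} {v} fu≡fv = ≟-sound (Equivalence.to ∨-not-true⇔
      (Equivalence.to (row⇔ u) (Equivalence.to rows⇔ ok u) v) (≟-complete fu≡fv))
    complete : IsInjective f → isInjᵇ f ≡ true
    complete f-inj = Equivalence.from rows⇔ λ u → Equivalence.from (row⇔ u) λ v →
      Equivalence.from ∨-not-true⇔ (λ e → ≟-complete (f-inj (≟-sound e)))

  isInjᵇ-≡ : ∀ {m n k} {f : Fin m → Fin n} {g : Fin m → Fin k} →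
    (IsInjective f ⇔ IsInjective g) → isInjᵇ f ≡ isInjᵇ g
  isInjᵇ-≡ {f = f} {g} f⇔g = ⇔→≡ (⇔.trans (isInjᵇ⇔ f) (⇔.trans f⇔g (⇔.sym (isInjᵇ⇔ g))))

  isInjᵇ-cong : ∀ {m n} {f g : Fin m → Fin n} → (∀ x → f x ≡ g x) → isInjᵇ f ≡ isInjᵇ g
  isInjᵇ-cong {f = f} {g} f≗g = isInjᵇ-≡ {f = f} {g = g} (mk⇔
    (λ f-inj {_} {_} e → f-inj (trans (f≗g _) (trans e (sym (f≗g _)))))
    (λ g-inj {_} {_} e → g-inj (trans (sym (f≗g _)) (trans e (f≗g _)))))

  isInjᵇ-∘ : ∀ {m k n} (ψ : Fin k → Fin n) (q : Fin m → Fin k) → IsInjective ψ → isInjᵇ (ψ ∘ q) ≡ isInjᵇ q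
  isInjᵇ-∘ ψ q ψ-inj = isInjᵇ-≡ {f = ψ ∘ q} {g = q}
    (mk⇔ (λ ψq-inj {_} {_} e → ψq-inj (cong ψ e)) (λ q-inj {_} {_} e → q-inj (ψ-inj e)))

  fresh : ∀ {k n} → (Fin k → Fin n) → Fin n → Bool
  fresh {zero}  f i = true
  fresh {suc k} f i = not ⌊ i ≟ f zero ⌋ ∧ fresh (f ∘ suc) i

  fresh⇔ : ∀ {k n} (f : Fin k → Fin n) i → fresh f i ≡ true ⇔ (∀ v → ¬ i ≡ f v)
  fresh⇔ {zero}  f i = mk⇔ (λ _ ()) (λ _ → refl)
  fresh⇔ {suc k} f i = mk⇔ to from
    where
    to : fresh f i ≡ true → ∀ v → ¬ i ≡ f v
    to ok zero    = Equivalence.to not-true⇔ (∧-conicalˡ _ _ ok) ∘ ≟-complete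
    to ok (suc v) = Equivalence.to (fresh⇔ (f ∘ suc) i) (∧-conicalʳ _ _ ok) v
    from : (∀ v → ¬ i ≡ f v) → fresh f i ≡ true
    from out = Equivalence.from ∧-true⇔
      (Equivalence.from not-true⇔ (out zero ∘ ≟-sound) , Equivalence.from (fresh⇔ (f ∘ suc) i) (out ∘ suc))

  ∷-injective⇔ : ∀ {k n} (i : Fin n) (f : Fin k → Fin n) →
    IsInjective (i ∷ᶠ f) ⇔ ((∀ v → ¬ i ≡ f v) × IsInjective f)
  ∷-injective⇔ i f = mk⇔ to from
    where
    to : IsInjective (i ∷ᶠ f) → (∀ v → ¬ i ≡ f v) × IsInjective f
    to inj = (λ v e → Finₚ.0≢1+n (inj {zero} {suc v} e)) , (λ e → Finₚ.suc-injective (inj e))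
    from : (∀ v → ¬ i ≡ f v) × IsInjective f → IsInjective (i ∷ᶠ f)
    from (out , f-inj) {zero}  {zero}  e = refl
    from (out , f-inj) {zero}  {suc v} e = ⊥-elim (out v e)
    from (out , f-inj) {suc u} {zero}  e = ⊥-elim (out u (sym e))
    from (out , f-inj) {suc u} {suc v} e = cong suc (f-inj e)

  isInjᵇ-∷ : ∀ {k n} (i : Fin n) (f : Fin k → Fin n) → isInjᵇ (i ∷ᶠ f) ≡ (fresh f i ∧ isInjᵇ f)
  isInjᵇ-∷ i f = ⇔→≡ (⇔.trans (isInjᵇ⇔ (i ∷ᶠ f))
                      (⇔.trans (∷-injective⇔ i f) (⇔.sym (⇔.trans ∧-true⇔ (fresh⇔ f i ×-⇔ isInjᵇ⇔ f)))))

open Injectivity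

module Counting where

  open import Data.Integer using (_+_)
  open import Data.Integer.Properties using (+-identityˡ; +-identityʳ)
  open import Data.Bool.Properties using (∧-zeroʳ; ∧-identityʳ)
  open ≡ using (refl; cong; cong₂; sym; trans)
  open ≡.≡-Reasoning
  open Σℤ

  ∑-image : ∀ {k n} (f : Fin k → Fin n) → IsInjective f → (h : Fin n → ℤ) →
    ∑[ i < n ] (not (fresh f i) · h i) ≡ ∑[ j < k ] h (f j)
  ∑-image {zero}  {n} f f-inj h = sum-replicate-zero n
  ∑-image {suc k} {n} f f-inj h = begin
    ∑[ i < n ] (not (fresh f i) · h i)
      ≡⟨ sum-cong-≋ first-or-rest ⟩
    ∑[ i < n ] (⌊ f zero ≟ i ⌋ · h i + not (fresh (f ∘ suc) i) · h i)
      ≡⟨ ∑-distrib-+ (λ i → ⌊ f zero ≟ i ⌋ · h i) (λ i → not (fresh (f ∘ suc) i) · h i) ⟩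
    ∑[ i < n ] (⌊ f zero ≟ i ⌋ · h i) + ∑[ i < n ] (not (fresh (f ∘ suc) i) · h i)
      ≡⟨ cong₂ _+_ (∑-delta (f zero) h) (∑-image (f ∘ suc) (Finₚ.suc-injective ∘ f-inj) h) ⟩
    h (f zero) + ∑[ j < k ] h (f (suc j)) ∎
    where
    first-or-rest : ∀ i → not (fresh f i) · h i ≡ ⌊ f zero ≟ i ⌋ · h i + not (fresh (f ∘ suc) i) · h i
    first-or-rest i with f zero ≟ i
    ... | yes refl rewrite ≟-refl (f zero)
                         | Equivalence.from (fresh⇔ (f ∘ suc) (f zero)) (λ v e → Finₚ.0≢1+n (f-inj e))
                         = sym (+-identityʳ _)
    ... | no f0≢i rewrite ≟-≢ (f0≢i ∘ sym) = sym (+-identityˡ _)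

  -- a point i either lies in the image of f or is fresh, and then (i ∷ᶠ f) is injective iff f is
  split-point : ∀ {k n} (f : Fin k → Fin n) (H : Fin n → ℤ) →
    isInjᵇ f · Σᴸ (allFin n) H
    ≡ ∑[ j < k ] (isInjᵇ f · H (f j)) + Σᴸ (allFin n) (λ i → isInjᵇ (i ∷ᶠ f) · H i)
  split-point {k} {n} f H with isInjᵇ f in f-ok
  ... | false =
    sym (cong₂ _+_ (sum-replicate-zero k) (trans (Σᴸ-cong (allFin n) extension-fails) (Σᴸ-zero (allFin n))))
    where
    extension-fails : ∀ i → isInjᵇ (i ∷ᶠ f) · H i ≡ 0ℤ
    extension-fails i rewrite isInjᵇ-∷ i f | f-ok | ∧-zeroʳ (fresh f i) = refl
  ... | true = begin
    Σᴸ (allFin n) H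
      ≡⟨ Σᴸ-allFin n H ⟩
    ∑[ i < n ] H i
      ≡⟨ sum-cong-≋ (λ i → image-or-fresh (fresh f i) (H i)) ⟩
    ∑[ i < n ] (not (fresh f i) · H i + fresh f i · H i)
      ≡⟨ ∑-distrib-+ (λ i → not (fresh f i) · H i) (λ i → fresh f i · H i) ⟩
    ∑[ i < n ] (not (fresh f i) · H i) + ∑[ i < n ] (fresh f i · H i)
      ≡⟨ cong₂ _+_ (∑-image f (Equivalence.to (isInjᵇ⇔ f) f-ok) H)
                   (trans (sum-cong-≋ extension-ok) (sym (Σᴸ-allFin n _))) ⟩
    ∑[ j < k ] H (f j) + Σᴸ (allFin n) (λ i → isInjᵇ (i ∷ᶠ f) · H i) ∎
    where
    image-or-fresh : ∀ b x → x ≡ not b · x + b · x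
    image-or-fresh true  x = sym (+-identityˡ x)
    image-or-fresh false x = sym (+-identityʳ x)
    extension-ok : ∀ i → fresh f i · H i ≡ isInjᵇ (i ∷ᶠ f) · H i
    extension-ok i rewrite isInjᵇ-∷ i f | f-ok | ∧-identityʳ (fresh f i) = refl

  -- Extending an injection ψ : Fin k → Fin n by a point i: either i = ψ j for some j,
  -- or (i ∷ᶠ ψ) is an injection Fin (suc k) → Fin n.
  Σ-extend : ∀ {k n} (H : (Fin k → Fin n) → Fin n → ℤ) →
    Σᴸ (inj k n) (λ ψ → Σᴸ (allFin n) (H ψ))
    ≡ ∑[ j < k ] Σᴸ (inj k n) (λ ψ → H ψ (ψ j)) + Σᴸ (inj (suc k) n) (λ ψ → H (ψ ∘ suc) (ψ zero))
  Σ-extend {k} {n} H = begin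
    Σᴸ (inj k n) (λ ψ → Σᴸ (allFin n) (H ψ))
      ≡⟨ Σᴸ-filter isInjᵇ (allFuns k n) _ ⟩
    Σᴸ (allFuns k n) (λ f → isInjᵇ f · Σᴸ (allFin n) (H f))
      ≡⟨ Σᴸ-cong (allFuns k n) (λ f → split-point f (H f)) ⟩
    Σᴸ (allFuns k n) (λ f → ∑[ j < k ] (isInjᵇ f · H f (f j)) + Σᴸ (allFin n) (λ i → isInjᵇ (i ∷ᶠ f) · H f i))
      ≡⟨ Σᴸ-distrib (allFuns k n) _ _ ⟩
    Σᴸ (allFuns k n) (λ f → ∑[ j < k ] (isInjᵇ f · H f (f j)))
      + Σᴸ (allFuns k n) (λ f → Σᴸ (allFin n) (λ i → isInjᵇ (i ∷ᶠ f) · H f i))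
      ≡⟨ cong₂ _+_ (Σᴸ-∑-comm (allFuns k n) (λ f j → isInjᵇ f · H f (f j))) extensions ⟩
    ∑[ j < k ] Σᴸ (allFuns k n) (λ f → isInjᵇ f · H f (f j))
      + Σᴸ (inj (suc k) n) (λ ψ → H (ψ ∘ suc) (ψ zero))
      ≡⟨ cong (_+ Σᴸ (inj (suc k) n) (λ ψ → H (ψ ∘ suc) (ψ zero)))
              (sum-cong-≋ (λ j → sym (Σᴸ-filter isInjᵇ (allFuns k n) (λ ψ → H ψ (ψ j))))) ⟩
    ∑[ j < k ] Σᴸ (inj k n) (λ ψ → H ψ (ψ j)) + Σᴸ (inj (suc k) n) (λ ψ → H (ψ ∘ suc) (ψ zero)) ∎
    where
    extensions : Σᴸ (allFuns k n) (λ f → Σᴸ (allFin n) (λ i → isInjᵇ (i ∷ᶠ f) · H f i))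
               ≡ Σᴸ (inj (suc k) n) (λ ψ → H (ψ ∘ suc) (ψ zero))
    extensions = sym (begin
      Σᴸ (inj (suc k) n) (λ ψ → H (ψ ∘ suc) (ψ zero))
        ≡⟨ Σᴸ-filter isInjᵇ (allFuns (suc k) n) _ ⟩
      Σᴸ (allFuns (suc k) n) (λ ψ → isInjᵇ ψ · H (ψ ∘ suc) (ψ zero))
        ≡⟨ Σᴸ-concatMap (λ f → map (_∷ᶠ f) (allFin n)) (allFuns k n) _ ⟩
      Σᴸ (allFuns k n) (λ f → Σᴸ (map (_∷ᶠ f) (allFin n)) (λ ψ → isInjᵇ ψ · H (ψ ∘ suc) (ψ zero)))
        ≡⟨ Σᴸ-cong (allFuns k n) (λ f → Σᴸ-map (_∷ᶠ f) (allFin n) _) ⟩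
      Σᴸ (allFuns k n) (λ f → Σᴸ (allFin n) (λ i → isInjᵇ (i ∷ᶠ f) · H f i)) ∎)

open Counting

module Overlaps where

  open import Data.Nat using (_≤_; _+_; s≤s)
  open import Data.Nat.Properties using (≤-reflexive; ≤-trans; +-monoʳ-≤; n≤1+n; +-suc; +-identityʳ)
  open import Data.Integer using () renaming (_+_ to _+ℤ_)
  open import Data.Integer.Properties using () renaming (+-identityʳ to +ℤ-identityʳ)
  open ≡ using (refl; cong; cong₂; sym; trans)
  open ≡.≡-Reasoning
  open Σℤ

  -- The points are the vertices of Fin size; the a distinct points are placed by the
  -- injection left, the N further points by right (which may repeat vertices).
  record Overlap (a N : ℕ) : Set where
    constructor mkOverlap
    field
      size           : ℕ
      left           : Fin a → Fin size
      right          : Fin N → Fin size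
      left-injective : IsInjective left
      size≤          : size ≤ a + N
  open Overlap public

  module _ {a N : ℕ} (p : Overlap a N) where

    reuse : Fin (size p) → Overlap a (suc N)
    reuse j = mkOverlap (size p) (left p) (j ∷ᶠ right p) (left-injective p)
                      (≤-trans (size≤ p) (+-monoʳ-≤ a (n≤1+n N)))

    new : Overlap a (suc N)
    new = mkOverlap (suc (size p)) (suc ∘ left p) (zero ∷ᶠ (suc ∘ right p))
                  (left-injective p ∘ Finₚ.suc-injective)
                  (≤-trans (s≤s (size≤ p)) (≤-reflexive (sym (+-suc a N))))

    extensions : List (Overlap a (suc N))
    extensions = map reuse (allFin (size p)) ++ new ∷ []

  overlaps : ∀ a N → List (Overlap a N)
  overlaps a zero    = mkOverlap a id (λ ()) id (≤-reflexive (sym (+-identityʳ a))) ∷ []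
  overlaps a (suc N) = concatMap extensions (overlaps a N)

  Extensional : ∀ {a N n} → ((Fin a → Fin n) → (Fin N → Fin n) → ℤ) → Set
  Extensional G = ∀ {φ φ' f f'} → (∀ x → φ x ≡ φ' x) → (∀ x → f x ≡ f' x) → G φ f ≡ G φ' f'

  -- A pair (φ, f) of an injection and a map is the same as an overlap p together with an
  -- injection ψ of its vertices: φ = ψ ∘ left p and f = ψ ∘ right p.
  Σ-overlaps : ∀ a n N (G : (Fin a → Fin n) → (Fin N → Fin n) → ℤ) → Extensional G →
    Σᴸ (inj a n) (λ φ → Σᴸ (allFuns N n) (G φ))
    ≡ Σᴸ (overlaps a N) (λ p → Σᴸ (inj (size p) n) (λ ψ → G (ψ ∘ left p) (ψ ∘ right p)))
  Σ-overlaps a n zero G G-ext =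
    trans (Σᴸ-cong (inj a n) (λ φ → trans (+ℤ-identityʳ _) (G-ext (λ _ → refl) (λ ())))) (sym (+ℤ-identityʳ _))
  Σ-overlaps a n (suc N) G G-ext = begin
    Σᴸ (inj a n) (λ φ → Σᴸ (allFuns (suc N) n) (G φ))
      ≡⟨ Σᴸ-cong (inj a n) (λ φ → trans (Σᴸ-concatMap (λ f → map (_∷ᶠ f) (allFin n)) (allFuns N n) (G φ))
                                        (Σᴸ-cong (allFuns N n) (λ f → Σᴸ-map (_∷ᶠ f) (allFin n) (G φ)))) ⟩
    Σᴸ (inj a n) (λ φ → Σᴸ (allFuns N n) (G′ φ))
      ≡⟨ Σ-overlaps a n N G′ G′-ext ⟩
    Σᴸ (overlaps a N) (λ p → Σᴸ (inj (size p) n) (λ ψ → G′ (ψ ∘ left p) (ψ ∘ right p)))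
      ≡⟨ Σᴸ-cong (overlaps a N) per-overlap ⟩
    Σᴸ (overlaps a N) (λ p → Σᴸ (extensions p) F)
      ≡⟨ sym (Σᴸ-concatMap extensions (overlaps a N) F) ⟩
    Σᴸ (overlaps a (suc N)) F ∎
    where
    G′ : (Fin a → Fin n) → (Fin N → Fin n) → ℤ
    G′ φ f = Σᴸ (allFin n) (λ i → G φ (i ∷ᶠ f))
    G′-ext : Extensional G′
    G′-ext φ≗φ' f≗f' = Σᴸ-cong (allFin n) (λ i → G-ext φ≗φ' (λ { zero → refl ; (suc x) → f≗f' x }))
    F : Overlap a (suc N) → ℤ
    F p = Σᴸ (inj (size p) n) (λ ψ → G (ψ ∘ left p) (ψ ∘ right p))
    ∷-∘ : ∀ {k} (ψ : Fin k → Fin n) (j : Fin k) (q : Fin N → Fin k) x → (ψ j ∷ᶠ (ψ ∘ q)) x ≡ (ψ ∘ (j ∷ᶠ q)) x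
    ∷-∘ ψ j q zero    = refl
    ∷-∘ ψ j q (suc x) = refl
    per-overlap : ∀ p → Σᴸ (inj (size p) n) (λ ψ → G′ (ψ ∘ left p) (ψ ∘ right p)) ≡ Σᴸ (extensions p) F
    per-overlap p = begin
      Σᴸ (inj (size p) n) (λ ψ → G′ (ψ ∘ left p) (ψ ∘ right p))
        ≡⟨ Σ-extend (λ ψ i → G (ψ ∘ left p) (i ∷ᶠ (ψ ∘ right p))) ⟩
      ∑[ j < size p ] Σᴸ (inj (size p) n) (λ ψ → G (ψ ∘ left p) (ψ j ∷ᶠ (ψ ∘ right p)))
        +ℤ Σᴸ (inj (suc (size p)) n) (λ ψ → G (ψ ∘ suc ∘ left p) (ψ zero ∷ᶠ (ψ ∘ suc ∘ right p)))
        ≡⟨ cong₂ _+ℤ_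
             (sum-cong-≋ (λ j → Σᴸ-cong (inj (size p) n) (λ ψ → G-ext (λ _ → refl) (∷-∘ ψ j (right p)))))
             (trans (Σᴸ-cong (inj (suc (size p)) n) (λ ψ → G-ext (λ _ → refl) (∷-∘ ψ zero (suc ∘ right p))))
                    (sym (+ℤ-identityʳ _))) ⟩
      ∑[ j < size p ] F (reuse p j) +ℤ (F (new p) +ℤ 0ℤ)
        ≡⟨ cong (_+ℤ (F (new p) +ℤ 0ℤ))
                (sym (trans (Σᴸ-map (reuse p) (allFin (size p)) F) (Σᴸ-allFin (size p) (F ∘ reuse p)))) ⟩
      Σᴸ (map (reuse p) (allFin (size p))) F +ℤ Σᴸ (new p ∷ []) F
        ≡⟨ sym (Σᴸ-++ (map (reuse p) (allFin (size p))) (new p ∷ []) F) ⟩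
      Σᴸ (extensions p) F ∎

open Overlaps

module ⊕ = BigSum (CommutativeRing.+-commutativeMonoid xor-∧-commutativeRing)

module Monomials where

  open ⊕
  open ≡ using (refl; cong; cong₂; sym; trans)
  open ≡.≡-Reasoning

  lt : ∀ {k} → Fin k → Fin k → Bool
  lt u v = toℕ u <ᵇ toℕ v

  ex-prodM : ∀ {A : Set} {n} (g : A → Mono n) xs i j → ex (prodM (map g xs)) i j ≡ Σᴸ xs (λ x → ex (g x) i j)
  ex-prodM g []       i j = refl
  ex-prodM g (x ∷ xs) i j = cong (ex (g x) i j xor_) (ex-prodM g xs i j)

  vy-prodM : ∀ {A : Set} {n} (g : A → Mono n) xs i → vy (prodM (map g xs)) i ≡ Σᴸ xs (λ x → vy (g x) i)
  vy-prodM g []       i = refl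
  vy-prodM g (x ∷ xs) i = cong (vy (g x) i xor_) (vy-prodM g xs i)

  edgeForm : ∀ {m n} → Graph m → (Fin m → Fin n) → Fin n → Fin n → Bool
  edgeForm {m} J φ i j = ∑[ u < m ] ∑[ v < m ] ((lt u v ∧ adj J u v) · ex (xM (φ u) (φ v)) i j)

  labelForm : ∀ {m n} → Subset m → (Fin m → Fin n) → Fin n → Bool
  labelForm {m} L φ i = ∑[ u < m ] (lookup L u · ⌊ i ≟ φ u ⌋)

  ex-monoOf : ∀ {m n} (J : Graph m) (L : Subset m) (φ : Fin m → Fin n) i j →
    ex (monoOf J L φ) i j ≡ edgeForm J φ i j
  ex-monoOf {m} J L φ i j = trans (cong₂ _xor_ edge-part label-part) (xor-identityʳ _)
    where
    listed : Fin m × Fin m → Bool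
    listed e = lt (proj₁ e) (proj₂ e) ∧ adj J (proj₁ e) (proj₂ e)
    X : Fin m × Fin m → Bool
    X e = ex (xM (φ (proj₁ e)) (φ (proj₂ e))) i j
    edge-part : ex (prodM (map (λ e → xM (φ (proj₁ e)) (φ (proj₂ e))) (edges J))) i j ≡ edgeForm J φ i j
    edge-part = begin
      ex (prodM (map (λ e → xM (φ (proj₁ e)) (φ (proj₂ e))) (edges J))) i j
        ≡⟨ ex-prodM (λ e → xM (φ (proj₁ e)) (φ (proj₂ e))) (edges J) i j ⟩
      Σᴸ (edges J) X
        ≡⟨ Σᴸ-filter listed (concatMap (λ u → map (u ,_) (allFin m)) (allFin m)) X ⟩
      Σᴸ (concatMap (λ u → map (u ,_) (allFin m)) (allFin m)) (λ e → listed e · X e)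
        ≡⟨ Σᴸ-concatMap (λ u → map (u ,_) (allFin m)) (allFin m) _ ⟩
      Σᴸ (allFin m) (λ u → Σᴸ (map (u ,_) (allFin m)) (λ e → listed e · X e))
        ≡⟨ Σᴸ-cong (allFin m) (λ u → trans (Σᴸ-map (u ,_) (allFin m) _) (Σᴸ-allFin m _)) ⟩
      Σᴸ (allFin m) (λ u → ∑[ v < m ] (listed (u , v) · X (u , v)))
        ≡⟨ Σᴸ-allFin m _ ⟩
      edgeForm J φ i j ∎
    label-part : ex (prodM (map (λ u → yM (φ u)) (filterᵇ (lookup L) (allFin m)))) i j ≡ false
    label-part = trans (ex-prodM (λ u → yM (φ u)) (filterᵇ (lookup L) (allFin m)) i j)
                       (Σᴸ-zero (filterᵇ (lookup L) (allFin m)))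

  vy-monoOf : ∀ {m n} (J : Graph m) (L : Subset m) (φ : Fin m → Fin n) i →
    vy (monoOf J L φ) i ≡ labelForm L φ i
  vy-monoOf {m} J L φ i = cong₂ _xor_ edge-part label-part
    where
    edge-part : vy (prodM (map (λ e → xM (φ (proj₁ e)) (φ (proj₂ e))) (edges J))) i ≡ false
    edge-part = trans (vy-prodM (λ e → xM (φ (proj₁ e)) (φ (proj₂ e))) (edges J) i) (Σᴸ-zero (edges J))
    label-part : vy (prodM (map (λ u → yM (φ u)) (filterᵇ (lookup L) (allFin m)))) i ≡ labelForm L φ i
    label-part = begin
      vy (prodM (map (λ u → yM (φ u)) (filterᵇ (lookup L) (allFin m)))) i
        ≡⟨ vy-prodM (λ u → yM (φ u)) (filterᵇ (lookup L) (allFin m)) i ⟩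
      Σᴸ (filterᵇ (lookup L) (allFin m)) (λ u → ⌊ i ≟ φ u ⌋)
        ≡⟨ Σᴸ-filter (lookup L) (allFin m) (λ u → ⌊ i ≟ φ u ⌋) ⟩
      Σᴸ (allFin m) (λ u → lookup L u · ⌊ i ≟ φ u ⌋)
        ≡⟨ Σᴸ-allFin m _ ⟩
      labelForm L φ i ∎

  _≋M_ : ∀ {n} → Mono n → Mono n → Set
  a ≋M b = (∀ i j → ex a i j ≡ ex b i j) × (∀ i → vy a i ≡ vy b i)

  allᵇ-cong : ∀ {A : Set} {p p' : A → Bool} → (∀ x → p x ≡ p' x) → ∀ xs → allᵇ p xs ≡ allᵇ p' xs
  allᵇ-cong p≗p' []       = refl
  allᵇ-cong p≗p' (x ∷ xs) = cong₂ _∧_ (p≗p' x) (allᵇ-cong p≗p' xs)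

  ==M-cong : ∀ {n} {a b : Mono n} → a ≋M b → ∀ c → (a ==M c) ≡ (b ==M c)
  ==M-cong {n} (ex≡ , vy≡) c = cong₂ _∧_
    (allᵇ-cong (λ i → allᵇ-cong (λ j → cong (λ e → not (e xor ex c i j)) (ex≡ i j)) (allFin n)) (allFin n))
    (allᵇ-cong (λ i → cong (λ e → not (e xor vy c i)) (vy≡ i)) (allFin n))

  *M-cong : ∀ {n} {a a' b b' : Mono n} → a ≋M a' → b ≋M b' → (a *M b) ≋M (a' *M b')
  *M-cong (ex≡a , vy≡a) (ex≡b , vy≡b) =
    (λ i j → cong₂ _xor_ (ex≡a i j) (ex≡b i j)) , (λ i → cong₂ _xor_ (vy≡a i) (vy≡b i))

  monoOf-cong : ∀ {m n} (J : Graph m) (L : Subset m) {φ φ' : Fin m → Fin n} → (∀ x → φ x ≡ φ' x) →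
    monoOf J L φ ≋M monoOf J L φ'
  monoOf-cong {m} J L {φ} {φ'} φ≗φ' =
    (λ i j → trans (ex-monoOf J L φ i j) (trans (edgeForm≡ i j) (sym (ex-monoOf J L φ' i j)))) ,
    (λ i → trans (vy-monoOf J L φ i) (trans (labelForm≡ i) (sym (vy-monoOf J L φ' i))))
    where
    edgeForm≡ : ∀ i j → edgeForm J φ i j ≡ edgeForm J φ' i j
    edgeForm≡ i j = sum-cong-≋ (λ u → sum-cong-≋ (λ v →
      cong₂ (λ a b → (lt u v ∧ adj J u v) · ex (xM a b) i j) (φ≗φ' u) (φ≗φ' v)))
    labelForm≡ : ∀ i → labelForm L φ i ≡ labelForm L φ' i
    labelForm≡ i = sum-cong-≋ (λ u → cong (λ a → lookup L u · ⌊ i ≟ a ⌋) (φ≗φ' u))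

open Monomials

module BoolWeights where

  open ⊕ using (_·_)
  open import Data.Bool.Properties using (xor-same)
  open ≡ using (refl)

  -- on Bool, a weight is a multiplication by 0 or 1: it commutes with everything
  ·-false : ∀ b → b · false ≡ false
  ·-false true  = refl
  ·-false false = refl

  ·-comm : ∀ a b → a · b ≡ b · a
  ·-comm true  true  = refl
  ·-comm true  false = refl
  ·-comm false true  = refl
  ·-comm false false = refl

  xor-· : ∀ a b x → (a xor b) · x ≡ a · x xor b · x
  xor-· true  true  x = ≡.sym (xor-same x)
  xor-· true  false x = ≡.sym (xor-identityʳ x)
  xor-· false b     x = refl

  ∧-·-comm : ∀ c d x → (c ∧ d) · x ≡ (c · x) · d
  ∧-·-comm true  d x = ·-comm d x
  ∧-·-comm false d x = refl

  weight-true : ∀ {b x} → b · x ≡ true → b ≡ true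
  weight-true {true} _ = refl

  ·-·-comm : ∀ p x a → (p · x) · a ≡ p · a · x
  ·-·-comm true  x a = ·-comm x a
  ·-·-comm false x a = refl

open BoolWeights

module Orientation where

  open ⊕
  open import Data.Bool.Properties using (xor-same; xor-annihilates-not)
  open ≡ using (refl; cong; cong₂; sym; trans)
  open ≡.≡-Reasoning

  -- a symmetric form with zero diagonal sums to zero: the terms (s,t) and (t,s) cancel
  ∑-symmetric : ∀ {k} (D : Fin k → Fin k → Bool) → (∀ s t → D s t ≡ D t s) → (∀ s → D s s ≡ false) →
    ∑[ s < k ] ∑[ t < k ] D s t ≡ false
  ∑-symmetric {zero}  D D-sym D-diag = refl
  ∑-symmetric {suc k} D D-sym D-diag = begin
    (D zero zero xor R) xor ∑[ s < k ] (D (suc s) zero xor ∑[ t < k ] D (suc s) (suc t))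
      ≡⟨ cong₂ (λ d x → (d xor R) xor x) (D-diag zero)
               (∑-distrib-+ (λ s → D (suc s) zero) (λ s → ∑[ t < k ] D (suc s) (suc t))) ⟩
    R xor (∑[ s < k ] D (suc s) zero xor ∑[ s < k ] ∑[ t < k ] D (suc s) (suc t))
      ≡⟨ cong₂ (λ x y → R xor (x xor y)) (sum-cong-≋ (λ s → D-sym (suc s) zero))
               (∑-symmetric (λ s t → D (suc s) (suc t)) (λ s t → D-sym (suc s) (suc t)) (D-diag ∘ suc)) ⟩
    R xor (R xor false)
      ≡⟨ cong (R xor_) (xor-identityʳ R) ⟩
    R xor R
      ≡⟨ xor-same R ⟩
    false ∎
    where
    R : Bool
    R = ∑[ t < k ] D zero (suc t)

  Orients : ∀ {k} → (Fin k → Fin k → Bool) → (Fin k → Fin k → Bool) → Set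
  Orients P E = ∀ s t → E s t ≡ true → (P s t xor P t s) ≡ true

  xor-true : ∀ {p q} → (p xor q) ≡ true → q ≡ not p
  xor-true {true}  {false} _ = refl
  xor-true {false} {true}  _ = refl

  xor-false : ∀ {p q} → (p xor q) ≡ false → p ≡ q
  xor-false {true}  {true}  _ = refl
  xor-false {false} {false} _ = refl

  difference-symmetric : ∀ p q p' q' e → (e ≡ true → (p xor q) ≡ true) → (e ≡ true → (p' xor q') ≡ true) →
    (p xor p') · e ≡ (q xor q') · e
  difference-symmetric p q p' q' false _ _ = trans (·-false _) (sym (·-false _))
  difference-symmetric p q p' q' true oP oP' = cong (_· true) (begin
    p xor p'         ≡⟨ sym (xor-annihilates-not p p') ⟩
    not p xor not p' ≡⟨ cong₂ _xor_ (sym (xor-true {p} {q} (oP refl))) (sym (xor-true {p'} {q'} (oP' refl))) ⟩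
    q xor q'         ∎)

  ∑-orientation : ∀ {k} (E P P' : Fin k → Fin k → Bool) → (∀ s t → E s t ≡ E t s) → (∀ s → E s s ≡ false) →
    Orients P E → Orients P' E →
    ∑[ s < k ] ∑[ t < k ] (P s t · E s t) ≡ ∑[ s < k ] ∑[ t < k ] (P' s t · E s t)
  ∑-orientation {k} E P P' E-sym E-diag oP oP' = xor-false (begin
    ∑[ s < k ] ∑[ t < k ] (P s t · E s t) xor ∑[ s < k ] ∑[ t < k ] (P' s t · E s t)
      ≡⟨ sym (∑-distrib-+ (λ s → ∑[ t < k ] (P s t · E s t)) (λ s → ∑[ t < k ] (P' s t · E s t))) ⟩
    ∑[ s < k ] (∑[ t < k ] (P s t · E s t) xor ∑[ t < k ] (P' s t · E s t))
      ≡⟨ sum-cong-≋ (λ s → sym (∑-distrib-+ (λ t → P s t · E s t) (λ t → P' s t · E s t))) ⟩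
    ∑[ s < k ] ∑[ t < k ] (P s t · E s t xor P' s t · E s t)
      ≡⟨ sum-cong-≋ (λ s → sum-cong-≋ (λ t → sym (xor-· (P s t) (P' s t) (E s t)))) ⟩
    ∑[ s < k ] ∑[ t < k ] D s t
      ≡⟨ ∑-symmetric D D-sym D-diag ⟩
    false ∎)
    where
    D : Fin k → Fin k → Bool
    D s t = (P s t xor P' s t) · E s t
    D-sym : ∀ s t → D s t ≡ D t s
    D-sym s t = trans (difference-symmetric (P s t) (P t s) (P' s t) (P' t s) (E s t) (oP s t) (oP' s t))
                      (cong ((P t s xor P' t s) ·_) (E-sym s t))
    D-diag : ∀ s → D s s ≡ false
    D-diag s rewrite E-diag s = ·-false _

open Orientation

module Merging where

  open ⊕
  open import Data.Bool.Properties using (∧-assoc; ∧-identityʳ; ∧-zeroʳ; ∨-comm)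
  import Data.Vec as Vec
  open import Data.Vec.Properties using (lookup∘tabulate)
  open ≡ using (refl; cong; cong₂; sym; trans)
  open ≡.≡-Reasoning

  <ᵇ-irrefl : ∀ m → (m <ᵇ m) ≡ false
  <ᵇ-irrefl zero    = refl
  <ᵇ-irrefl (suc m) = <ᵇ-irrefl m

  <ᵇ-connex : ∀ m n → ¬ m ≡ n → ((m <ᵇ n) xor (n <ᵇ m)) ≡ true
  <ᵇ-connex zero    zero    m≢n = ⊥-elim (m≢n refl)
  <ᵇ-connex zero    (suc n) m≢n = refl
  <ᵇ-connex (suc m) zero    m≢n = refl
  <ᵇ-connex (suc m) (suc n) m≢n = <ᵇ-connex m n (m≢n ∘ cong suc)

  lt-orients : ∀ {k} (u v : Fin k) → ¬ u ≡ v → (lt u v xor lt v u) ≡ true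
  lt-orients u v u≢v = <ᵇ-connex (toℕ u) (toℕ v) (u≢v ∘ Finₚ.toℕ-injective)

  lt-distinct : ∀ {k} (u v : Fin k) → (lt u v ∧ not ⌊ u ≟ v ⌋) ≡ lt u v
  lt-distinct u v with u ≟ v
  ... | yes refl = trans (∧-zeroʳ (lt u u)) (sym (<ᵇ-irrefl (toℕ u)))
  ... | no _     = ∧-identityʳ (lt u v)

  pushAdj : ∀ {a k} → (Fin a → Fin k) → Graph a → Fin k → Fin k → Bool
  pushAdj r J u v = push r (λ s → push r (adj J s) v) u

  pushAdj-expand : ∀ {a k} (r : Fin a → Fin k) (J : Graph a) u v →
    pushAdj r J u v ≡ ∑[ s < a ] ∑[ t < a ] (⌊ r s ≟ u ⌋ · ⌊ r t ≟ v ⌋ · adj J s t)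
  pushAdj-expand {a} r J u v = sum-cong-≋ (λ s → ·-∑ ⌊ r s ≟ u ⌋ (λ t → ⌊ r t ≟ v ⌋ · adj J s t))

  pushAdj-sym : ∀ {a k} (r : Fin a → Fin k) (J : Graph a) u v → pushAdj r J u v ≡ pushAdj r J v u
  pushAdj-sym {a} r J u v = begin
    pushAdj r J u v
      ≡⟨ pushAdj-expand r J u v ⟩
    ∑[ s < a ] ∑[ t < a ] (⌊ r s ≟ u ⌋ · ⌊ r t ≟ v ⌋ · adj J s t)
      ≡⟨ ∑-comm (λ s t → ⌊ r s ≟ u ⌋ · ⌊ r t ≟ v ⌋ · adj J s t) ⟩
    ∑[ t < a ] ∑[ s < a ] (⌊ r s ≟ u ⌋ · ⌊ r t ≟ v ⌋ · adj J s t)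
      ≡⟨ sum-cong-≋ (λ t → sum-cong-≋ (λ s →
           trans (·-exchange ⌊ r s ≟ u ⌋ ⌊ r t ≟ v ⌋ (adj J s t))
                 (cong (λ e → ⌊ r t ≟ v ⌋ · ⌊ r s ≟ u ⌋ · e) (Graph.sym J s t)))) ⟩
    ∑[ t < a ] ∑[ s < a ] (⌊ r t ≟ v ⌋ · ⌊ r s ≟ u ⌋ · adj J t s)
      ≡⟨ sym (pushAdj-expand r J v u) ⟩
    pushAdj r J v u ∎

  ∑-pushAdj : ∀ {a k} (r : Fin a → Fin k) (J : Graph a) (W : Fin k → Fin k → Bool) →
    ∑[ u < k ] ∑[ v < k ] (W u v · pushAdj r J u v) ≡ ∑[ s < a ] ∑[ t < a ] (W (r s) (r t) · adj J s t)
  ∑-pushAdj {a} {k} r J W = begin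
    ∑[ u < k ] ∑[ v < k ] (W u v · pushAdj r J u v)
      ≡⟨ ∑-comm (λ u v → W u v · pushAdj r J u v) ⟩
    ∑[ v < k ] ∑[ u < k ] (W u v · push r (λ s → push r (adj J s) v) u)
      ≡⟨ sum-cong-≋ (λ v → ∑-push r (λ s → push r (adj J s) v) (λ u → W u v)) ⟩
    ∑[ v < k ] ∑[ s < a ] (W (r s) v · push r (adj J s) v)
      ≡⟨ ∑-comm (λ v s → W (r s) v · push r (adj J s) v) ⟩
    ∑[ s < a ] ∑[ v < k ] (W (r s) v · push r (adj J s) v)
      ≡⟨ sum-cong-≋ (λ s → ∑-push r (adj J s) (W (r s))) ⟩
    ∑[ s < a ] ∑[ t < a ] (W (r s) (r t) · adj J s t) ∎

  merge : ∀ {a b k} → (Fin a → Fin k) → Graph a → (Fin b → Fin k) → Graph b → Graph k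
  merge r J₁ q J₂ = record
    { adj    = λ u v → not ⌊ u ≟ v ⌋ ∧ (pushAdj r J₁ u v xor pushAdj q J₂ u v)
    ; sym    = λ u v → cong₂ (λ e x → not e ∧ x) (≟-sym u v)
                             (cong₂ _xor_ (pushAdj-sym r J₁ u v) (pushAdj-sym q J₂ u v))
    ; irrefl = λ u → cong (λ e → not e ∧ (pushAdj r J₁ u u xor pushAdj q J₂ u u)) (≟-refl u)
    }

  mergeLabels : ∀ {a b k} → (Fin a → Fin k) → Subset a → (Fin b → Fin k) → Subset b → Subset k
  mergeLabels r L₁ q L₂ = Vec.tabulate (λ u → push r (lookup L₁) u xor push q (lookup L₂) u)

  xM-sym : ∀ {n} (a b i j : Fin n) → ex (xM a b) i j ≡ ex (xM b a) i j
  xM-sym a b i j = ∨-comm (⌊ i ≟ a ⌋ ∧ ⌊ j ≟ b ⌋) (⌊ i ≟ b ⌋ ∧ ⌊ j ≟ a ⌋)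

  -- The edges of J pushed forward along an injection r contribute the edge part of J under ψ ∘ r.
  -- The pushforward may reverse the orientation of an edge; the orientation lemma absorbs this.
  edgeForm-push : ∀ {a k n} (r : Fin a → Fin k) → IsInjective r → (J : Graph a) (ψ : Fin k → Fin n) (i j : Fin n) →
    ∑[ u < k ] ∑[ v < k ] ((lt u v · ex (xM (ψ u) (ψ v)) i j) · pushAdj r J u v) ≡ edgeForm J (ψ ∘ r) i j
  edgeForm-push {a} {k} r r-inj J ψ i j = begin
    ∑[ u < k ] ∑[ v < k ] ((lt u v · ex (xM (ψ u) (ψ v)) i j) · pushAdj r J u v)
      ≡⟨ ∑-pushAdj r J (λ u v → lt u v · ex (xM (ψ u) (ψ v)) i j) ⟩
    ∑[ s < a ] ∑[ t < a ] ((lt (r s) (r t) · ex (xM (ψ (r s)) (ψ (r t))) i j) · adj J s t)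
      ≡⟨ sum-cong-≋ (λ s → sum-cong-≋ (λ t → ·-·-comm (lt (r s) (r t)) _ (adj J s t))) ⟩
    ∑[ s < a ] ∑[ t < a ] (lt (r s) (r t) · E s t)
      ≡⟨ ∑-orientation E (λ s t → lt (r s) (r t)) lt E-sym E-diag
           (λ s t e → lt-orients (r s) (r t) (distinct s t e ∘ r-inj)) (λ s t e → lt-orients s t (distinct s t e)) ⟩
    ∑[ s < a ] ∑[ t < a ] (lt s t · E s t)
      ≡⟨ sum-cong-≋ (λ s → sum-cong-≋ (λ t → sym (∧-· (lt s t) (adj J s t) _))) ⟩
    edgeForm J (ψ ∘ r) i j ∎
    where
    E : Fin a → Fin a → Bool
    E s t = adj J s t · ex (xM (ψ (r s)) (ψ (r t))) i j
    E-sym : ∀ s t → E s t ≡ E t s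
    E-sym s t = cong₂ _·_ (Graph.sym J s t) (xM-sym (ψ (r s)) (ψ (r t)) i j)
    E-diag : ∀ s → E s s ≡ false
    E-diag s rewrite Graph.irrefl J s = refl
    distinct : ∀ s t → E s t ≡ true → ¬ s ≡ t
    distinct s t e s≡t = case trans (sym (Graph.irrefl J s)) (trans (cong (adj J s) s≡t) (weight-true e)) of λ ()

  labelForm-push : ∀ {a k n} (r : Fin a → Fin k) (L : Subset a) (ψ : Fin k → Fin n) (i : Fin n) →
    ∑[ u < k ] (push r (lookup L) u · ⌊ i ≟ ψ u ⌋) ≡ labelForm L (ψ ∘ r) i
  labelForm-push {a} {k} r L ψ i = begin
    ∑[ u < k ] (push r (lookup L) u · ⌊ i ≟ ψ u ⌋)
      ≡⟨ sum-cong-≋ (λ u → ·-comm (push r (lookup L) u) _) ⟩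
    ∑[ u < k ] (⌊ i ≟ ψ u ⌋ · push r (lookup L) u)
      ≡⟨ ∑-push r (lookup L) (λ u → ⌊ i ≟ ψ u ⌋) ⟩
    ∑[ s < a ] (⌊ i ≟ ψ (r s) ⌋ · lookup L s)
      ≡⟨ sum-cong-≋ (λ s → ·-comm _ (lookup L s)) ⟩
    labelForm L (ψ ∘ r) i ∎

  module _ {a b k n : ℕ} (J₁ : Graph a) (L₁ : Subset a) (J₂ : Graph b) (L₂ : Subset b)
           (r : Fin a → Fin k) (q : Fin b → Fin k) (r-inj : IsInjective r) (q-inj : IsInjective q)
           (ψ : Fin k → Fin n) where

    ex-merge : ∀ i j → ex (monoOf (merge r J₁ q J₂) (mergeLabels r L₁ q L₂) ψ) i j
                     ≡ ex (monoOf J₁ L₁ (ψ ∘ r) *M monoOf J₂ L₂ (ψ ∘ q)) i j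
    ex-merge i j = begin
      ex (monoOf (merge r J₁ q J₂) (mergeLabels r L₁ q L₂) ψ) i j
        ≡⟨ ex-monoOf (merge r J₁ q J₂) (mergeLabels r L₁ q L₂) ψ i j ⟩
      ∑[ u < k ] ∑[ v < k ] ((lt u v ∧ adj (merge r J₁ q J₂) u v) · X u v)
        ≡⟨ sum-cong-≋ (λ u → sum-cong-≋ (λ v → split-weight u v)) ⟩
      ∑[ u < k ] ∑[ v < k ] (W u v · pushAdj r J₁ u v xor W u v · pushAdj q J₂ u v)
        ≡⟨ sum-cong-≋ (λ u → ∑-distrib-+ (λ v → W u v · pushAdj r J₁ u v) (λ v → W u v · pushAdj q J₂ u v)) ⟩
      ∑[ u < k ] (∑[ v < k ] (W u v · pushAdj r J₁ u v) xor ∑[ v < k ] (W u v · pushAdj q J₂ u v))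
        ≡⟨ ∑-distrib-+ (λ u → ∑[ v < k ] (W u v · pushAdj r J₁ u v)) (λ u → ∑[ v < k ] (W u v · pushAdj q J₂ u v)) ⟩
      ∑[ u < k ] ∑[ v < k ] (W u v · pushAdj r J₁ u v) xor ∑[ u < k ] ∑[ v < k ] (W u v · pushAdj q J₂ u v)
        ≡⟨ cong₂ _xor_ (edgeForm-push r r-inj J₁ ψ i j) (edgeForm-push q q-inj J₂ ψ i j) ⟩
      edgeForm J₁ (ψ ∘ r) i j xor edgeForm J₂ (ψ ∘ q) i j
        ≡⟨ sym (cong₂ _xor_ (ex-monoOf J₁ L₁ (ψ ∘ r) i j) (ex-monoOf J₂ L₂ (ψ ∘ q) i j)) ⟩
      ex (monoOf J₁ L₁ (ψ ∘ r) *M monoOf J₂ L₂ (ψ ∘ q)) i j ∎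
      where
      X : Fin k → Fin k → Bool
      X u v = ex (xM (ψ u) (ψ v)) i j
      W : Fin k → Fin k → Bool
      W u v = lt u v · X u v
      split-weight : ∀ u v → (lt u v ∧ adj (merge r J₁ q J₂) u v) · X u v
                           ≡ W u v · pushAdj r J₁ u v xor W u v · pushAdj q J₂ u v
      split-weight u v = begin
        (lt u v ∧ (not ⌊ u ≟ v ⌋ ∧ (pushAdj r J₁ u v xor pushAdj q J₂ u v))) · X u v
          ≡⟨ cong (_· X u v) (sym (∧-assoc (lt u v) _ _)) ⟩
        ((lt u v ∧ not ⌊ u ≟ v ⌋) ∧ (pushAdj r J₁ u v xor pushAdj q J₂ u v)) · X u v
          ≡⟨ cong (λ c → (c ∧ (pushAdj r J₁ u v xor pushAdj q J₂ u v)) · X u v) (lt-distinct u v) ⟩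
        (lt u v ∧ (pushAdj r J₁ u v xor pushAdj q J₂ u v)) · X u v
          ≡⟨ ∧-·-comm (lt u v) _ (X u v) ⟩
        W u v · (pushAdj r J₁ u v xor pushAdj q J₂ u v)
          ≡⟨ ·-distrib (W u v) (pushAdj r J₁ u v) (pushAdj q J₂ u v) ⟩
        W u v · pushAdj r J₁ u v xor W u v · pushAdj q J₂ u v ∎

    vy-merge : ∀ i → vy (monoOf (merge r J₁ q J₂) (mergeLabels r L₁ q L₂) ψ) i
                   ≡ vy (monoOf J₁ L₁ (ψ ∘ r) *M monoOf J₂ L₂ (ψ ∘ q)) i
    vy-merge i = begin
      vy (monoOf (merge r J₁ q J₂) (mergeLabels r L₁ q L₂) ψ) i
        ≡⟨ vy-monoOf (merge r J₁ q J₂) (mergeLabels r L₁ q L₂) ψ i ⟩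
      ∑[ u < k ] (lookup (mergeLabels r L₁ q L₂) u · ⌊ i ≟ ψ u ⌋)
        ≡⟨ sum-cong-≋ (λ u → trans (cong (_· ⌊ i ≟ ψ u ⌋) (lookup∘tabulate _ u)) (xor-· (push r (lookup L₁) u) _ _)) ⟩
      ∑[ u < k ] (push r (lookup L₁) u · ⌊ i ≟ ψ u ⌋ xor push q (lookup L₂) u · ⌊ i ≟ ψ u ⌋)
        ≡⟨ ∑-distrib-+ (λ u → push r (lookup L₁) u · ⌊ i ≟ ψ u ⌋) (λ u → push q (lookup L₂) u · ⌊ i ≟ ψ u ⌋) ⟩
      ∑[ u < k ] (push r (lookup L₁) u · ⌊ i ≟ ψ u ⌋) xor ∑[ u < k ] (push q (lookup L₂) u · ⌊ i ≟ ψ u ⌋)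
        ≡⟨ cong₂ _xor_ (labelForm-push r L₁ ψ i) (labelForm-push q L₂ ψ i) ⟩
      labelForm L₁ (ψ ∘ r) i xor labelForm L₂ (ψ ∘ q) i
        ≡⟨ sym (cong₂ _xor_ (vy-monoOf J₁ L₁ (ψ ∘ r) i) (vy-monoOf J₂ L₂ (ψ ∘ q) i)) ⟩
      vy (monoOf J₁ L₁ (ψ ∘ r) *M monoOf J₂ L₂ (ψ ∘ q)) i ∎

    monoOf-merge : monoOf (merge r J₁ q J₂) (mergeLabels r L₁ q L₂) ψ
                   ≋M (monoOf J₁ L₁ (ψ ∘ r) *M monoOf J₂ L₂ (ψ ∘ q))
    monoOf-merge = ex-merge , vy-merge

open Merging

module Expansion where

  open Σℤ
  open import Data.Integer using (_+_; _*_)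
  open import Data.Integer.Properties using (+-identityˡ)
  open ≡ using (refl; cong; cong₂; sym; trans)
  open ≡.≡-Reasoning

  coeff-Σᴸ : ∀ {n} (p : Poly n) c → coeff p c ≡ Σᴸ p (λ t → (proj₂ t ==M c) · proj₁ t)
  coeff-Σᴸ []            c = refl
  coeff-Σᴸ ((d , a) ∷ p) c with a ==M c
  ... | true  = cong (d +_) (coeff-Σᴸ p c)
  ... | false = trans (coeff-Σᴸ p c) (sym (+-identityˡ _))

  coeff-sumP : ∀ {n} (ps : List (Poly n)) c → coeff (sumP ps) c ≡ Σᴸ ps (λ p → coeff p c)
  coeff-sumP []       c = refl
  coeff-sumP (p ∷ ps) c = begin
    coeff (p ++ sumP ps) c
      ≡⟨ coeff-Σᴸ (p ++ sumP ps) c ⟩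
    Σᴸ (p ++ sumP ps) (λ t → (proj₂ t ==M c) · proj₁ t)
      ≡⟨ Σᴸ-++ p (sumP ps) _ ⟩
    Σᴸ p (λ t → (proj₂ t ==M c) · proj₁ t) + Σᴸ (sumP ps) (λ t → (proj₂ t ==M c) · proj₁ t)
      ≡⟨ cong₂ _+_ (sym (coeff-Σᴸ p c)) (trans (sym (coeff-Σᴸ (sumP ps) c)) (coeff-sumP ps c)) ⟩
    coeff p c + Σᴸ ps (λ p → coeff p c) ∎

  coeff-k̃ : ∀ {m} (J : Graph m) (L : Subset m) n c →
    coeff (k̃ J L n) c ≡ Σᴸ (allFuns m n) (λ φ → isInjᵇ φ · (monoOf J L φ ==M c) · 1ℤ)
  coeff-k̃ {m} J L n c = begin
    coeff (k̃ J L n) c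
      ≡⟨ coeff-Σᴸ (k̃ J L n) c ⟩
    Σᴸ (map (λ φ → (1ℤ , monoOf J L φ)) (inj m n)) (λ t → (proj₂ t ==M c) · proj₁ t)
      ≡⟨ Σᴸ-map (λ φ → (1ℤ , monoOf J L φ)) (inj m n) _ ⟩
    Σᴸ (inj m n) (λ φ → (monoOf J L φ ==M c) · 1ℤ)
      ≡⟨ Σᴸ-filter isInjᵇ (allFuns m n) _ ⟩
    Σᴸ (allFuns m n) (λ φ → isInjᵇ φ · (monoOf J L φ ==M c) · 1ℤ) ∎

  injectiveOverlaps : ∀ a b → List (Overlap a b)
  injectiveOverlaps a b = filterᵇ (isInjᵇ ∘ right) (overlaps a b)

  Term : Set
  Term = Σ ℕ (λ m → Graph m × Subset m)

  k̃-term : Term → (n : ℕ) → Poly n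
  k̃-term t n = k̃ (proj₁ (proj₂ t)) (proj₂ (proj₂ t)) n

  module _ {m₁ m₂ : ℕ} (J₁ : Graph m₁) (L₁ : Subset m₁) (J₂ : Graph m₂) (L₂ : Subset m₂) where

    mergedTerm : Overlap m₁ m₂ → Term
    mergedTerm p = size p , merge (left p) J₁ (right p) J₂ , mergeLabels (left p) L₁ (right p) L₂

    module _ (n : ℕ) (c : Mono n) where

      pairWeight : (Fin m₁ → Fin n) → (Fin m₂ → Fin n) → ℤ
      pairWeight φ f = isInjᵇ f · ((monoOf J₁ L₁ φ *M monoOf J₂ L₂ f) ==M c) · 1ℤ

      pairWeight-ext : Extensional pairWeight
      pairWeight-ext φ≗φ' f≗f' = cong₂ (λ b e → b · e · 1ℤ) (isInjᵇ-cong f≗f')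
        (==M-cong (*M-cong (monoOf-cong J₁ L₁ φ≗φ') (monoOf-cong J₂ L₂ f≗f')) c)

      coeff-pairs : coeff (k̃ J₁ L₁ n *P k̃ J₂ L₂ n) c ≡ Σᴸ (inj m₁ n) (λ φ → Σᴸ (allFuns m₂ n) (pairWeight φ))
      coeff-pairs = begin
        coeff (k̃ J₁ L₁ n *P k̃ J₂ L₂ n) c
          ≡⟨ coeff-Σᴸ (k̃ J₁ L₁ n *P k̃ J₂ L₂ n) c ⟩
        Σᴸ (k̃ J₁ L₁ n *P k̃ J₂ L₂ n) weight
          ≡⟨ Σᴸ-concatMap (λ s → map (λ t → (proj₁ s * proj₁ t , proj₂ s *M proj₂ t)) (k̃ J₂ L₂ n)) (k̃ J₁ L₁ n) weight ⟩
        Σᴸ (k̃ J₁ L₁ n) (λ s → Σᴸ (map (λ t → (proj₁ s * proj₁ t , proj₂ s *M proj₂ t)) (k̃ J₂ L₂ n)) weight)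
          ≡⟨ Σᴸ-map (λ φ → (1ℤ , monoOf J₁ L₁ φ)) (inj m₁ n) _ ⟩
        Σᴸ (inj m₁ n) (λ φ → Σᴸ (map (λ t → (1ℤ * proj₁ t , monoOf J₁ L₁ φ *M proj₂ t)) (k̃ J₂ L₂ n)) weight)
          ≡⟨ Σᴸ-cong (inj m₁ n) (λ φ → trans (Σᴸ-map _ (k̃ J₂ L₂ n) weight)
               (trans (Σᴸ-map (λ f → (1ℤ , monoOf J₂ L₂ f)) (inj m₂ n) _) (Σᴸ-filter isInjᵇ (allFuns m₂ n) _))) ⟩
        Σᴸ (inj m₁ n) (λ φ → Σᴸ (allFuns m₂ n) (pairWeight φ)) ∎
        where
        weight : ℤ × Mono n → ℤ
        weight t = (proj₂ t ==M c) · proj₁ t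

      coeff-overlap : ∀ p → Σᴸ (inj (size p) n) (λ ψ → pairWeight (ψ ∘ left p) (ψ ∘ right p))
                            ≡ isInjᵇ (right p) · coeff (k̃-term (mergedTerm p) n) c
      coeff-overlap p = begin
        Σᴸ (inj (size p) n) (λ ψ → pairWeight (ψ ∘ left p) (ψ ∘ right p))
          ≡⟨ Σᴸ-filter isInjᵇ (allFuns (size p) n) _ ⟩
        Σᴸ (allFuns (size p) n) (λ ψ → isInjᵇ ψ · pairWeight (ψ ∘ left p) (ψ ∘ right p))
          ≡⟨ Σᴸ-cong (allFuns (size p) n) placement ⟩
        Σᴸ (allFuns (size p) n) (λ ψ → isInjᵇ (right p) · isInjᵇ ψ · (monoOf Jₚ Lₚ ψ ==M c) · 1ℤ)
          ≡⟨ sym (·-Σᴸ (isInjᵇ (right p)) (allFuns (size p) n) _) ⟩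
        isInjᵇ (right p) · Σᴸ (allFuns (size p) n) (λ ψ → isInjᵇ ψ · (monoOf Jₚ Lₚ ψ ==M c) · 1ℤ)
          ≡⟨ cong (isInjᵇ (right p) ·_) (sym (coeff-k̃ Jₚ Lₚ n c)) ⟩
        isInjᵇ (right p) · coeff (k̃-term (mergedTerm p) n) c ∎
        where
        Jₚ : Graph (size p)
        Jₚ = merge (left p) J₁ (right p) J₂
        Lₚ : Subset (size p)
        Lₚ = mergeLabels (left p) L₁ (right p) L₂
        -- for injective ψ, ψ ∘ right p is injective iff right p is, and then the monomials agree
        placement : ∀ ψ → isInjᵇ ψ · pairWeight (ψ ∘ left p) (ψ ∘ right p)
                        ≡ isInjᵇ (right p) · isInjᵇ ψ · (monoOf Jₚ Lₚ ψ ==M c) · 1ℤ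
        placement ψ with isInjᵇ ψ in ψ-ok
        ... | false = sym (·-ε (isInjᵇ (right p)))
        ... | true rewrite isInjᵇ-∘ ψ (right p) (Equivalence.to (isInjᵇ⇔ ψ) ψ-ok) with isInjᵇ (right p) in q-ok
        ...   | false = refl
        ...   | true  = cong (_· 1ℤ) (sym (==M-cong (monoOf-merge J₁ L₁ J₂ L₂ (left p) (right p) (left-injective p)
                                                      (Equivalence.to (isInjᵇ⇔ (right p)) q-ok) ψ) c))

      coeff-product : coeff (k̃ J₁ L₁ n *P k̃ J₂ L₂ n) c
                      ≡ Σᴸ (injectiveOverlaps m₁ m₂) (λ p → coeff (k̃-term (mergedTerm p) n) c)
      coeff-product = begin
        coeff (k̃ J₁ L₁ n *P k̃ J₂ L₂ n) c
          ≡⟨ coeff-pairs ⟩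
        Σᴸ (inj m₁ n) (λ φ → Σᴸ (allFuns m₂ n) (pairWeight φ))
          ≡⟨ Σ-overlaps m₁ n m₂ pairWeight pairWeight-ext ⟩
        Σᴸ (overlaps m₁ m₂) (λ p → Σᴸ (inj (size p) n) (λ ψ → pairWeight (ψ ∘ left p) (ψ ∘ right p)))
          ≡⟨ Σᴸ-cong (overlaps m₁ m₂) coeff-overlap ⟩
        Σᴸ (overlaps m₁ m₂) (λ p → isInjᵇ (right p) · coeff (k̃-term (mergedTerm p) n) c)
          ≡⟨ sym (Σᴸ-filter (isInjᵇ ∘ right) (overlaps m₁ m₂) (λ p → coeff (k̃-term (mergedTerm p) n) c)) ⟩
        Σᴸ (injectiveOverlaps m₁ m₂) (λ p → coeff (k̃-term (mergedTerm p) n) c) ∎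

open Expansion
open import Data.Nat using (_≤_; _+_)
open import Data.List.Relation.Unary.All as All using (All)
open import Data.List.Relation.Unary.All.Properties using (map⁺)
open import Data.Product using (∃)

mainTheorem11 : ∀ {m₁ m₂} (J₁ : Graph m₁) (L₁ : Subset m₁) (J₂ : Graph m₂) (L₂ : Subset m₂) (n : ℕ) →
    ∃ λ (terms : List (Σ ℕ (λ m → Graph m × Subset m))) →
      All (λ t → proj₁ t ≤ m₁ + m₂) terms
      × ((k̃ J₁ L₁ n *P k̃ J₂ L₂ n)
          ≈P sumP (map (λ t → k̃ (proj₁ (proj₂ t)) (proj₂ (proj₂ t)) n) terms))
mainTheorem11 {m₁} {m₂} J₁ L₁ J₂ L₂ n =
  map term placements , map⁺ (All.tabulate (λ {p} _ → size≤ p)) , coefficients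
  where
  open Σℤ using (Σᴸ; Σᴸ-map)
  open ≡ using (sym; trans)
  open ≡.≡-Reasoning
  placements : List (Overlap m₁ m₂)
  placements = injectiveOverlaps m₁ m₂
  term : Overlap m₁ m₂ → Term
  term = mergedTerm J₁ L₁ J₂ L₂
  coefficients : (k̃ J₁ L₁ n *P k̃ J₂ L₂ n) ≈P sumP (map (λ t → k̃-term t n) (map term placements))
  coefficients c = begin
    coeff (k̃ J₁ L₁ n *P k̃ J₂ L₂ n) c
      ≡⟨ coeff-product J₁ L₁ J₂ L₂ n c ⟩
    Σᴸ placements (λ p → coeff (k̃-term (term p) n) c)
      ≡⟨ sym (trans (Σᴸ-map (λ t → k̃-term t n) (map term placements) _) (Σᴸ-map term placements _)) ⟩
    Σᴸ (map (λ t → k̃-term t n) (map term placements)) (λ p → coeff p c)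
      ≡⟨ sym (coeff-sumP (map (λ t → k̃-term t n) (map term placements)) c) ⟩
    coeff (sumP (map (λ t → k̃-term t n) (map term placements))) c ∎
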